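{- Let $A$ be a finite set with $|A| = q$, let $r$ and $t$ be positive integers, and set $m = 2rt$. Let $f: A^{2r+1} \to A$ be a bipermutive local rule, and let $\mathcal{F}: A^{2m} \to A^m$ be the cellular automaton $\langle 2m, r, t, f\rangle$. Then the square $L_{\mathcal{F}}$ associated to $\mathcal{F}$ is a Latin square of order $q^m$ over $X = \{1, \dots, q^m\}$.
   Context: Cellular automaton: for positive integers $n, r, t$ with $t < \lfloor n/(2r) \rfloor$ and a function $f: A^{2r+1} \to A$, the CA $\langle n, r, t, f\rangle$ is the map $\mathcal{F} = F_{t-1} \circ \cdots \circ F_1 \circ F_0 : A^n \to A^{n-2rt}$, where for $i \in \{0, \dots, t-1\}$ the global rule $F_i: A^{n-2ri} \to A^{n-2r(i+1)}$ is $F_i(x) = (f(x_0, \dots, x_{2r}), f(x_1, \dots, x_{2r+1}), \dots, f(x_{n-2r(i+1)-1}, \dots, x_{n-2ri-1}))$ for $x = (x_0, \dots, x_{n-2ri-1})$, i.e. the $j$-th output coordinate is $f(x_j, \dots, x_{j+2r})$. The rule $f$ is rightmost (resp. leftmost) permutive if for every fixed value of the first (resp. last) $2r$ variables, the resulting map of the remaining rightmost (resp. leftmost) variable is a permutation of $A$; $f$ is bipermutive if it is both. Associated square: fix a total order on $A^m$ and a monotone bijection $\phi: A^m \to \{1, \dots, q^m\}$ with inverse $\psi$; for the CA $\mathcal{F}: A^{2m} \to A^m$ with $m = 2rt$, the associated square is the $q^m \times q^m$ matrix with entries $L_{\mathcal{F}}(i,j) = \phi(\mathcal{F}(\psi(i)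 \| \psi(j)))$, where $\|$ denotes concatenation of vectors. A Latin square of order $v$ over a $v$-element set $X$ is a $v \times v$ matrix with entries in $X$ in which every row and every column is a permutation of $X$. -}

module Defs where

import Data.Nat
open import Data.Nat using (ℕ; zero; suc; _+_; _*_; _^_; _<_; s≤s; z≤n)
open import Data.Nat.Properties using (+-identityʳ; +-assoc; +-comm; +-monoʳ-<; +-mono-≤; ≤-refl; *-comm)
open import Data.Fin using (Fin; toℕ; fromℕ<)
open import Data.Fin.Properties using (toℕ<n)
import Data.Fin as F
import Data.Vec
open import Data.Vec using (Vec; lookup; tabulate; cast; _++_; _∷ʳ_; _∷_)
open import Data.Product using (_×_; _,_)
open import Function using (_∘_)
open import Function.Definitions using (Bijective)
open import Function.Bundles using (_↔_; Inverse)
open import Relation.Binary.PropositionalEquality using (_≡_; refl; sym; trans; cong)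
open import Relation.Binary.Structures using (IsStrictTotalOrder)

IsPermutation : {A : Set} → (A → A) → Set
IsPermutation = Bijective _≡_ _≡_

-- Local rule f : A^{2r+1} → A; vectors are indexed 0 .. 2r (x_0 is leftmost).
RightmostPermutive : {A : Set} (r : ℕ) → (Vec A (suc (2 * r)) → A) → Set
RightmostPermutive {A} r f = (xs : Vec A (2 * r)) → IsPermutation (λ a → f (cast (+-comm (2 * r) 1) (xs ++ (a ∷ Data.Vec.[]))))

LeftmostPermutive : {A : Set} (r : ℕ) → (Vec A (suc (2 * r)) → A) → Set
LeftmostPermutive {A} r f = (xs : Vec A (2 * r)) → IsPermutation (λ a → f (a ∷ xs))

Bipermutive : {A : Set} (r : ℕ) → (Vec A (suc (2 * r)) → A) → Set
Bipermutive r f = RightmostPermutive r f × LeftmostPermutive r f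

module CA {A : Set} (r : ℕ) (f : Vec A (suc (2 * r)) → A) where

  private
    idx : ∀ k → Fin k → Fin (suc (2 * r)) → Fin (k + 2 * r)
    idx k j i = fromℕ< {toℕ j + toℕ i} (+-mono-≤ (toℕ<n j) (sLe (toℕ<n i)))
      where
        sLe : ∀ {a b} → a < suc b → a Data.Nat.≤ b
        sLe (s≤s p) = p

  -- One global step: the j-th output is f (x_j , ... , x_{j+2r}).
  step : ∀ k → Vec A (k + 2 * r) → Vec A k
  step k x = tabulate (λ j → f (tabulate (λ i → lookup x (idx k j i))))

  private
    eq : ∀ k t → k + (2 * r + t * (2 * r)) ≡ (k + t * (2 * r)) + 2 * r
    eq k t = trans (sym (+-assoc k (2 * r) (t * (2 * r))))
             (trans (cong (_+ t * (2 * r)) (+-comm k (2 * r)))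
             (trans (+-assoc (2 * r) k (t * (2 * r))) (+-comm (2 * r) (k + t * (2 * r)))))

  iter : ∀ t k → Vec A (k + t * (2 * r)) → Vec A k
  iter zero k x = cast (+-identityʳ k) x
  iter (suc t) k x = iter t k (step (k + t * (2 * r)) (cast (eq k t) x))

  ca : (t : ℕ) → Vec A (2 * r * t + 2 * r * t) → Vec A (2 * r * t)
  ca t x = iter t (2 * r * t) (cast (cong (2 * r * t +_) (*-comm (2 * r) t)) x)

-- A Latin square of order v over Fin v (our rendering of {1,…,v}, shifted by one).
IsLatinSquare : (v : ℕ) → (Fin v → Fin v → Fin v) → Set
IsLatinSquare v L = ((i : Fin v) → IsPermutation (λ j → L i j)) × ((j : Fin v) → IsPermutation (λ i → L i j))

associatedSquare : {A : Set} {q m : ℕ} → (Vec A m ↔ Fin (q ^ m)) → (Vec A (m + m) → Vec A m) → Fin (q ^ m) → Fin (q ^ m) → Fin (q ^ m)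
associatedSquare φ F i j = Inverse.to φ (F (Inverse.from φ i ++ Inverse.from φ j))

module Submission where

-- Write T = t·2r for the total shrinking of the CA, so that iterating t
-- global steps maps A^(n+T) to A^n.  The whole proof rests on one
-- observation about a single global step, made precise by the notions
-- LeftExtension / RightExtension below: prepending (appending) a cell a to
-- the input prepends (appends) a cell p a to the output, where p is a
-- permutation of A depending only on the rest of the input.  This is exactly
-- leftmost (rightmost) permutivity of the local rule.  Both notions are
-- stable under composition and under casts, so they pass to the t-fold
-- iterate.  An induction on n then shows that, for a fixed block u of T cells,
-- the maps v ↦ F(u ++ v) and v ↦ F(v ++ u) are permutations of A^n: peel off
-- the last (first) cell of v and use that the extension is triangular.
-- Taking n = m = 2rt, a row (column) of the associated square is such a
-- permutation conjugated by the bijection φ, hence a permutation of Fin (q^m).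

open import Defs
open import Data.Nat using (ℕ; suc; _*_; _^_; NonZero)
open import Data.Fin using (Fin)
import Data.Fin as F
open import Data.Vec using (Vec)
open import Function.Bundles using (_↔_; Inverse)
open import Relation.Binary.PropositionalEquality using (_≡_)
open import Relation.Binary.Structures using (IsStrictTotalOrder)

open import Data.Nat using (zero; _+_; s≤s⁻¹)
open import Data.Nat.Properties using (+-comm; +-assoc; +-identityʳ; *-comm; suc-injective; +-mono-≤; ≤-trans; m≤n+m)
open import Data.Fin using (toℕ; fromℕ; fromℕ<; inject₁; _↑ʳ_)
open import Data.Fin.Properties using (toℕ<n; toℕ-fromℕ<; toℕ-fromℕ; toℕ-inject₁; toℕ-↑ʳ)
open import Data.Vec using ([]; _∷_; _∷ʳ_; _++_; [_]; tabulate; lookup; cast; initLast)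
open import Data.Vec.Properties
  using (∷-injective; ∷ʳ-injective; tabulate-cong; cast-∷ʳ; cast-sym; ++-∷ʳ-eqFree; unfold-∷ʳ-eqFree)
open import Data.Vec.Relation.Binary.Equality.Cast using (cast-trans)
open import Data.Product using (Σ-syntax; _×_; _,_; proj₁; proj₂)
open import Function using (_∘_; id)
open import Function.Bundles using (Bijection)
open import Function.Definitions using (Bijective)
open import Function.Properties.Inverse using (Inverse⇒Bijection)
open import Function.Construct.Symmetry using (↔-sym)
import Function.Construct.Composition as Compose
import Function.Construct.Identity as Identity
open import Relation.Binary.PropositionalEquality using (refl; sym; trans; cong; cong₂; module ≡-Reasoning)

conjugate : {B C : Set} (φ : B ↔ C) {H : B → B} → IsPermutation H →
            IsPermutation (Inverse.to φ ∘ H ∘ Inverse.from φ)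
conjugate φ H-perm =
  Compose.bijective _≡_ _≡_ _≡_ (Compose.bijective _≡_ _≡_ _≡_ (bijective (↔-sym φ)) H-perm) (bijective φ)
  where
  bijective : ∀ {X Y : Set} (ψ : X ↔ Y) → Bijective _≡_ _≡_ (Inverse.to ψ)
  bijective ψ = Bijection.bijective (Inverse⇒Bijection ψ)

module _ {A : Set} where

  permutation-Vec₀ : (H : Vec A 0 → Vec A 0) → IsPermutation H
  permutation-Vec₀ H = (λ {v} {v′} _ → unique v v′) , λ { [] → [] , λ { refl → unique _ _ } }
    where
    unique : (v v′ : Vec A 0) → v ≡ v′
    unique [] [] = refl

  LeftExtension : ∀ {m n} → (Vec A (suc m) → Vec A (suc n)) → (Vec A m → Vec A n) → Set
  LeftExtension F G = ∀ w → Σ[ p ∈ (A → A) ] IsPermutation p × (∀ a → F (a ∷ w) ≡ p a ∷ G w)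

  RightExtension : ∀ {m n} → (Vec A (suc m) → Vec A (suc n)) → (Vec A m → Vec A n) → Set
  RightExtension F G = ∀ w → Σ[ p ∈ (A → A) ] IsPermutation p × (∀ a → F (w ∷ʳ a) ≡ G w ∷ʳ p a)

  cast-left : ∀ {m n} .(e : suc m ≡ suc n) .(e′ : m ≡ n) → LeftExtension (cast {A = A} e) (cast e′)
  cast-left e e′ w = id , Identity.bijective _≡_ , λ a → refl

  cast-right : ∀ {m n} .(e : suc m ≡ suc n) .(e′ : m ≡ n) → RightExtension (cast {A = A} e) (cast e′)
  cast-right e e′ w = id , Identity.bijective _≡_ , λ a → cast-∷ʳ e a w

  left-∘ : ∀ {k l m} {F : Vec A (suc k) → Vec A (suc l)} {G : Vec A k → Vec A l}
           {F′ : Vec A (suc l) → Vec A (suc m)} {G′ : Vec A l → Vec A m} →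
           LeftExtension F G → LeftExtension F′ G′ → LeftExtension (F′ ∘ F) (G′ ∘ G)
  left-∘ {F′ = F′} FG F′G′ w =
    let (p , p-perm , F-eq) = FG w ; (p′ , p′-perm , F′-eq) = F′G′ _ in
    p′ ∘ p , Compose.bijective _≡_ _≡_ _≡_ p-perm p′-perm , λ a → trans (cong F′ (F-eq a)) (F′-eq (p a))

  right-∘ : ∀ {k l m} {F : Vec A (suc k) → Vec A (suc l)} {G : Vec A k → Vec A l}
            {F′ : Vec A (suc l) → Vec A (suc m)} {G′ : Vec A l → Vec A m} →
            RightExtension F G → RightExtension F′ G′ → RightExtension (F′ ∘ F) (G′ ∘ G)
  right-∘ {F′ = F′} FG F′G′ w =
    let (p , p-perm , F-eq) = FG w ; (p′ , p′-perm , F′-eq) = F′G′ _ in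
    p′ ∘ p , Compose.bijective _≡_ _≡_ _≡_ p-perm p′-perm , λ a → trans (cong F′ (F-eq a)) (F′-eq (p a))

  -- A triangular extension of a permutation is a permutation: the old part of
  -- the input is recovered from the old part of the output, then the new cell
  -- from the new cell of the output.
  left-permutation : ∀ {n} {F : Vec A (suc n) → Vec A (suc n)} {G : Vec A n → Vec A n} →
                     IsPermutation G → LeftExtension F G → IsPermutation F
  left-permutation {n} {F} {G} (G-inj , G-surj) FG = injective , surjective
    where
    injective : ∀ {v v′} → F v ≡ F v′ → v ≡ v′
    injective {a ∷ w} {a′ ∷ w′} Fv≡Fv′
      with ∷-injective (trans (sym (proj₂ (proj₂ (FG w)) a)) (trans Fv≡Fv′ (proj₂ (proj₂ (FG w′)) a′)))
    ... | pa≡pa′ , Gw≡Gw′ with G-inj Gw≡Gw′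
    ... | refl = cong (_∷ w) (proj₁ (proj₁ (proj₂ (FG w))) pa≡pa′)
    surjective : ∀ y → Σ[ x ∈ Vec A (suc n) ] (∀ {z} → z ≡ x → F z ≡ y)
    surjective (b ∷ y) =
      let (w , Gw≡y) = G-surj y ; (p , (_ , p-surj) , F-eq) = FG w ; (a , pa≡b) = p-surj b in
      a ∷ w , λ { refl → trans (F-eq a) (cong₂ _∷_ (pa≡b refl) (Gw≡y refl)) }

  right-permutation : ∀ {n} {F : Vec A (suc n) → Vec A (suc n)} {G : Vec A n → Vec A n} →
                      IsPermutation G → RightExtension F G → IsPermutation F
  right-permutation {n} {F} {G} (G-inj , G-surj) FG = injective , surjective
    where
    injective : ∀ {v v′} → F v ≡ F v′ → v ≡ v′
    injective {v} {v′} Fv≡Fv′ with initLast v | initLast v′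
    ... | w , a , refl | w′ , a′ , refl
      with ∷ʳ-injective _ _ (trans (sym (proj₂ (proj₂ (FG w)) a)) (trans Fv≡Fv′ (proj₂ (proj₂ (FG w′)) a′)))
    ... | Gw≡Gw′ , pa≡pa′ with G-inj Gw≡Gw′
    ... | refl = cong (w ∷ʳ_) (proj₁ (proj₁ (proj₂ (FG w))) pa≡pa′)
    surjective : ∀ y → Σ[ x ∈ Vec A (suc n) ] (∀ {z} → z ≡ x → F z ≡ y)
    surjective y with initLast y
    ... | y′ , b , refl =
      let (w , Gw≡y′) = G-surj y′ ; (p , (_ , p-surj) , F-eq) = FG w ; (a , pa≡b) = p-surj b in
      w ∷ʳ a , λ { refl → trans (F-eq a) (cong₂ _∷ʳ_ (Gw≡y′ refl) (pa≡b refl)) }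

  left-permutations : (H : ∀ n → Vec A n → Vec A n) → (∀ n → LeftExtension (H (suc n)) (H n)) →
                      ∀ n → IsPermutation (H n)
  left-permutations H ext zero    = permutation-Vec₀ (H zero)
  left-permutations H ext (suc n) = left-permutation (left-permutations H ext n) (ext n)

  right-permutations : (H : ∀ n → Vec A n → Vec A n) → (∀ n → RightExtension (H (suc n)) (H n)) →
                       ∀ n → IsPermutation (H n)
  right-permutations H ext zero    = permutation-Vec₀ (H zero)
  right-permutations H ext (suc n) = right-permutation (right-permutations H ext n) (ext n)

  prefix-right : ∀ {p m n} (u : Vec A p) .(e : p + suc m ≡ suc n) .(e′ : p + m ≡ n) →
                 RightExtension (cast e ∘ (u ++_)) (cast e′ ∘ (u ++_))
  prefix-right u e e′ w = id , Identity.bijective _≡_ , λ a → begin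
      cast e (u ++ (w ∷ʳ a))           ≡⟨ cong (cast e) (sym (++-∷ʳ-eqFree a u w)) ⟩
      cast e (cast _ ((u ++ w) ∷ʳ a))  ≡⟨ cast-trans _ e ((u ++ w) ∷ʳ a) ⟩
      cast _ ((u ++ w) ∷ʳ a)           ≡⟨ cast-∷ʳ _ a (u ++ w) ⟩
      cast e′ (u ++ w) ∷ʳ a            ∎
    where open ≡-Reasoning

-- Cells of a vector with an appended entry, located by their position in ℕ;
-- windows of a CA are indexed arithmetically, so this is how they are compared.

module _ {A : Set} where

  lookup-∷ʳ-init : ∀ {n} (w : Vec A n) (a : A) (i : Fin (suc n)) (j : Fin n) →
                   toℕ i ≡ toℕ j → lookup (w ∷ʳ a) i ≡ lookup w j
  lookup-∷ʳ-init (x ∷ w) a F.zero    F.zero    _   = refl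
  lookup-∷ʳ-init (x ∷ w) a (F.suc i) (F.suc j) i≡j = lookup-∷ʳ-init w a i j (suc-injective i≡j)

  lookup-∷ʳ-last : ∀ {n} (w : Vec A n) (a : A) (i : Fin (suc n)) → toℕ i ≡ n → lookup (w ∷ʳ a) i ≡ a
  lookup-∷ʳ-last []      a F.zero    _   = refl
  lookup-∷ʳ-last (x ∷ w) a (F.suc i) i≡n = lookup-∷ʳ-last w a i (suc-injective i≡n)

  tabulate-∷ʳ : ∀ {n} (g : Fin (suc n) → A) → tabulate g ≡ tabulate (g ∘ inject₁) ∷ʳ g (fromℕ n)
  tabulate-∷ʳ {zero}  g = refl
  tabulate-∷ʳ {suc n} g = cong (g F.zero ∷_) (tabulate-∷ʳ (g ∘ F.suc))

module Bipermutivity {A : Set} (r : ℕ) (f : Vec A (suc (2 * r)) → A) (bipermutive : Bipermutive r f) where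
  open CA r f
  open ≡-Reasoning

  cell : ∀ k → Fin k → Fin (suc (2 * r)) → Fin (k + 2 * r)
  cell k j i = fromℕ< (+-mono-≤ (toℕ<n j) (s≤s⁻¹ (toℕ<n i)))

  toℕ-cell : ∀ k j i → toℕ (cell k j i) ≡ toℕ j + toℕ i
  toℕ-cell k j i = toℕ-fromℕ< _

  window : ∀ k → Vec A (k + 2 * r) → Fin k → Vec A (suc (2 * r))
  window k x j = tabulate (λ i → lookup x (cell k j i))

  -- Leftmost permutivity: a new leftmost input cell a only enters the new leftmost
  -- output cell f (a ∷ first 2r cells of w).  Holds by computation.
  step-left : ∀ n → LeftExtension (step (suc n)) (step n)
  step-left n w = (λ a → f (a ∷ prefix)) , proj₂ bipermutive prefix , λ a → refl
    where
    prefix : Vec A (2 * r)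
    prefix = tabulate (λ i → lookup w (fromℕ< (≤-trans (toℕ<n i) (m≤n+m (2 * r) n))))


  -- Rightmost permutivity: a new rightmost input cell a only enters the new
  -- rightmost output cell f (last 2r cells of w ∷ʳ a).
  step-right : ∀ n → RightExtension (step (suc n)) (step n)
  step-right n w = (λ a → f (cast _ (suffix ++ [ a ]))) , proj₁ bipermutive suffix , λ a → begin
      step (suc n) (w ∷ʳ a)
    ≡⟨ tabulate-∷ʳ (f ∘ window (suc n) (w ∷ʳ a)) ⟩
      tabulate (f ∘ window (suc n) (w ∷ʳ a) ∘ inject₁) ∷ʳ f (window (suc n) (w ∷ʳ a) (fromℕ n))
    ≡⟨ cong₂ _∷ʳ_ (tabulate-cong (cong f ∘ old-window a)) (cong f (last-window a)) ⟩
      step n w ∷ʳ f (cast _ (suffix ++ [ a ]))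
    ∎
    where
    suffix : Vec A (2 * r)
    suffix = tabulate (λ i → lookup w (n ↑ʳ i))

    old-window : ∀ a j → window (suc n) (w ∷ʳ a) (inject₁ j) ≡ window n w j
    old-window a j = tabulate-cong λ i → lookup-∷ʳ-init w a _ _ (begin
      toℕ (cell (suc n) (inject₁ j) i)  ≡⟨ toℕ-cell (suc n) (inject₁ j) i ⟩
      toℕ (inject₁ j) + toℕ i           ≡⟨ cong (_+ toℕ i) (toℕ-inject₁ j) ⟩
      toℕ j + toℕ i                     ≡⟨ toℕ-cell n j i ⟨
      toℕ (cell n j i)                  ∎)

    last-window : ∀ a → window (suc n) (w ∷ʳ a) (fromℕ n) ≡ cast _ (suffix ++ [ a ])
    last-window a = begin
        window (suc n) (w ∷ʳ a) (fromℕ n)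
      ≡⟨ tabulate-∷ʳ (λ i → lookup (w ∷ʳ a) (cell (suc n) (fromℕ n) i)) ⟩
        tabulate (λ i → lookup (w ∷ʳ a) (cell (suc n) (fromℕ n) (inject₁ i)))
          ∷ʳ lookup (w ∷ʳ a) (cell (suc n) (fromℕ n) (fromℕ (2 * r)))
      ≡⟨ cong₂ _∷ʳ_ (tabulate-cong λ i → lookup-∷ʳ-init w a _ _ (begin
            toℕ (cell (suc n) (fromℕ n) (inject₁ i))  ≡⟨ toℕ-cell (suc n) (fromℕ n) (inject₁ i) ⟩
            toℕ (fromℕ n) + toℕ (inject₁ i)           ≡⟨ cong₂ _+_ (toℕ-fromℕ n) (toℕ-inject₁ i) ⟩
            n + toℕ i                                 ≡⟨ toℕ-↑ʳ n i ⟨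
            toℕ (n ↑ʳ i)                              ∎))
          (lookup-∷ʳ-last w a _ (begin
            toℕ (cell (suc n) (fromℕ n) (fromℕ (2 * r)))  ≡⟨ toℕ-cell (suc n) (fromℕ n) (fromℕ (2 * r)) ⟩
            toℕ (fromℕ n) + toℕ (fromℕ (2 * r))           ≡⟨ cong₂ _+_ (toℕ-fromℕ n) (toℕ-fromℕ (2 * r)) ⟩
            n + 2 * r                                     ∎)) ⟩
        suffix ∷ʳ a
      ≡⟨ cast-sym _ (unfold-∷ʳ-eqFree a suffix) ⟨
        cast _ (suffix ++ [ a ])
      ∎

  regroup : ∀ k t → k + (2 * r + t * (2 * r)) ≡ (k + t * (2 * r)) + 2 * r
  regroup k t = trans (cong (k +_) (+-comm (2 * r) (t * (2 * r)))) (sym (+-assoc k (t * (2 * r)) (2 * r)))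

  prefix-length : ∀ t {p} → p ≡ t * (2 * r) → ∀ n → p + n ≡ n + t * (2 * r)
  prefix-length t {p} p≡T n = trans (+-comm p n) (cong (n +_) p≡T)

  suffix-length : ∀ t {p} → p ≡ t * (2 * r) → ∀ n → n + p ≡ n + t * (2 * r)
  suffix-length t p≡T n = cong (n +_) p≡T

  iter-left : ∀ t k → LeftExtension (iter t (suc k)) (iter t k)
  iter-left zero    k = cast-left (+-identityʳ (suc k)) (+-identityʳ k)
  iter-left (suc t) k =
    left-∘ {F = step _ ∘ cast (regroup (suc k) t)} {F′ = iter t (suc k)}
      (left-∘ {F = cast (regroup (suc k) t)} {F′ = step _} (cast-left (regroup (suc k) t) (regroup k t)) (step-left _))
      (iter-left t k)

  iter-right : ∀ t k → RightExtension (iter t (suc k)) (iter t k)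
  iter-right zero    k = cast-right (+-identityʳ (suc k)) (+-identityʳ k)
  iter-right (suc t) k =
    right-∘ {F = step _ ∘ cast (regroup (suc k) t)} {F′ = iter t (suc k)}
      (right-∘ {F = cast (regroup (suc k) t)} {F′ = step _} (cast-right (regroup (suc k) t) (regroup k t)) (step-right _))
      (iter-right t k)

  -- Fixing a left block u of t·2r cells, v ↦ F(u ++ v) is a permutation of A^n.
  -- (Casts ignore their proofs, so for p = n = 2rt this map is v ↦ ca t (u ++ v).)
  rows : ∀ t {p} (p≡T : p ≡ t * (2 * r)) (u : Vec A p) →
         ∀ n → IsPermutation (λ v → iter t n (cast (prefix-length t p≡T n) (u ++ v)))
  rows t p≡T u = right-permutations _ λ n →
    right-∘ {F = cast (prefix-length t p≡T (suc n)) ∘ (u ++_)} {F′ = iter t (suc n)}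
      (prefix-right u (prefix-length t p≡T (suc n)) (prefix-length t p≡T n)) (iter-right t n)

  columns : ∀ t {p} (p≡T : p ≡ t * (2 * r)) (u : Vec A p) →
            ∀ n → IsPermutation (λ v → iter t n (cast (suffix-length t p≡T n) (v ++ u)))
  columns t p≡T u = left-permutations _ λ n →
    left-∘ {F = cast (suffix-length t p≡T (suc n)) ∘ (_++ u)} {F′ = iter t (suc n)}
      (λ w → cast-left (suffix-length t p≡T (suc n)) (suffix-length t p≡T n) (w ++ u)) (iter-left t n)

lemma3 : (A : Set) (q : ℕ) → A ↔ Fin q →
         (r t : ℕ) → .{{NonZero r}} → .{{NonZero t}} →
         (f : Vec A (suc (2 * r)) → A) → Bipermutive r f →
         (_<ₘ_ : Vec A (2 * r * t) → Vec A (2 * r * t) → Set) → IsStrictTotalOrder _≡_ _<ₘ_ →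
         (φ : Vec A (2 * r * t) ↔ Fin (q ^ (2 * r * t))) →
         (∀ u v → u <ₘ v → Inverse.to φ u F.< Inverse.to φ v) →
         IsLatinSquare (q ^ (2 * r * t)) (associatedSquare φ (CA.ca r f t))
lemma3 _ _ _ r t f bipermutive _ _ φ _ =
  (λ i → conjugate φ (rows t m≡T (Inverse.from φ i) m)) ,
  (λ j → conjugate φ (columns t m≡T (Inverse.from φ j) m))
  where
  open Bipermutivity r f bipermutive
  m : ℕ
  m = 2 * r * t
  m≡T : m ≡ t * (2 * r)
  m≡T = *-comm (2 * r) t
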